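{- Let $\{U_k\}_{k\in\omega}$ and $\{V_k\}_{k\in\omega}$ be sequences of theories such that for each $k$, $U_k$ is bi-interpretable with $V_k$. If $\{U_k\}_{k\in\omega}$ is retract-disjoint, then $\{V_k\}_{k\in\omega}$ is retract-disjoint.
   Context: Interpretations between theories are one-dimensional parameter-free translations; $T_1$ is a retract of $T_2$ if there are interpretations $\mathsf M_1$ of $T_1$ in $T_2$ and $\mathsf M_2$ of $T_2$ in $T_1$ such that the composite (first $\mathsf M_1$ then $\mathsf M_2$) is $T_1$-provably definably isomorphic to the identity interpretation; $T_1$ and $T_2$ are bi-interpretable if some pair of translations witnesses both that $T_1$ is a retract of $T_2$ and that $T_2$ is a retract of $T_1$. For structures (interpretations may use parameters): $\mathcal M$ is a retract of $\mathcal N$ if there are an interpretation $\mathsf N$ in $\mathcal M$ with $\mathcal M^{\mathsf N}\cong\mathcal N$ and an interpretation $\mathsf M$ in $\mathcal M^{\mathsf N}$ with an $\mathcal M$-definable isomorphism between $\mathcal M$ and $(\mathcal M^{\mathsf N})^{\mathsf M}$. A family $\{W_k\}$ of theories is retract-disjoint if whenever $\mathcal M\models W_k$, $\mathcal N\models W_n$ and $\mathcal M$ is a retract of $\mathcal N$, then $k=n$. -}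

module Defs where

open import Data.Nat using (ℕ; zero; suc; _+_)
open import Data.Fin using (Fin; zero; suc; _↑ˡ_; _↑ʳ_)
open import Data.Vec.Functional using (Vector; []; _∷_; _++_)
open import Data.Product using (Σ; Σ-syntax; _×_; _,_; proj₁; proj₂)
open import Data.Empty using (⊥)
open import Function using (_∘_; id)
open import Relation.Nullary using (¬_)
open import Relation.Binary.PropositionalEquality using (_≡_)

record Signature : Set₁ where
  field
    Fun      : Set
    funArity : Fun → ℕ
    Rel      : Set
    relArity : Rel → ℕ

open Signature public

data Term (L : Signature) (n : ℕ) : Set where
  var : Fin n → Term L n
  app : (f : Fun L) → Vector (Term L n) (funArity L f) → Term L n

infix  7 _≐_
infixr 4 _⇒_

data Formula (L : Signature) (n : ℕ) : Set where
  ⊥'  : Formula L n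
  _≐_ : Term L n → Term L n → Formula L n
  rel : (R : Rel L) → Vector (Term L n) (relArity L R) → Formula L n
  _⇒_ : Formula L n → Formula L n → Formula L n
  ∀'  : Formula L (suc n) → Formula L n

module _ {L : Signature} where

  ¬' : ∀ {n} → Formula L n → Formula L n
  ¬' φ = φ ⇒ ⊥'

  ⊤' : ∀ {n} → Formula L n
  ⊤' = ¬' ⊥'

  infixr 5 _∧'_
  _∧'_ : ∀ {n} → Formula L n → Formula L n → Formula L n
  φ ∧' ψ = ¬' (φ ⇒ ¬' ψ)

  ∃' : ∀ {n} → Formula L (suc n) → Formula L n
  ∃' φ = ¬' (∀' (¬' φ))

  existsN : ∀ k {m} → Formula L (k + m) → Formula L m
  existsN zero    φ = φ
  existsN (suc k) φ = existsN k (∃' φ)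

  bigAnd : ∀ k {m} → Vector (Formula L m) k → Formula L m
  bigAnd zero    φs = ⊤'
  bigAnd (suc k) φs = φs zero ∧' bigAnd k (φs ∘ suc)

  liftRen : ∀ {n m} → (Fin n → Fin m) → Fin (suc n) → Fin (suc m)
  liftRen ρ zero    = zero
  liftRen ρ (suc i) = suc (ρ i)

  renTerm : ∀ {n m} → (Fin n → Fin m) → Term L n → Term L m
  renTerm ρ (var i)    = var (ρ i)
  renTerm ρ (app f ts) = app f (λ i → renTerm ρ (ts i))

  renFormula : ∀ {n m} → (Fin n → Fin m) → Formula L n → Formula L m
  renFormula ρ ⊥'         = ⊥'
  renFormula ρ (t ≐ s)    = renTerm ρ t ≐ renTerm ρ s
  renFormula ρ (rel R ts) = rel R (λ i → renTerm ρ (ts i))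
  renFormula ρ (φ ⇒ ψ)    = renFormula ρ φ ⇒ renFormula ρ ψ
  renFormula ρ (∀' φ)     = ∀' (renFormula (liftRen ρ) φ)

Sentence : Signature → Set
Sentence L = Formula L 0

Theory : Signature → Set₁
Theory L = Sentence L → Set

-- Since Agda has no quotient types, a structure is given by a
-- carrier together with the relation interpreting '=', and function symbols
-- are interpreted by their graphs; the well-formedness conditions below
-- say that '=' is a congruence and the graphs are total and functional,
-- i.e. that the quotient is an ordinary first-order structure.
-- All conditions are read classically (via double negation).

record Structure (L : Signature) : Set₁ where
  field
    Carrier : Set
    _≈_     : Carrier → Carrier → Set
    relᴹ    : (R : Rel L) → Vector Carrier (relArity L R) → Set
    graphᴹ  : (f : Fun L) → Vector Carrier (funArity L f) → Carrier → Set



∣_∣ : {L : Signature} → Structure L → Set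
∣ M ∣ = Structure.Carrier M

record IsWellFormed {L : Signature} (M : Structure L) : Set where
  open Structure M
  field
    nonempty   : ¬ ¬ Carrier
    ≈-refl     : ∀ a → ¬ ¬ (a ≈ a)
    ≈-sym      : ∀ a b → ¬ ¬ (a ≈ b) → ¬ ¬ (b ≈ a)
    ≈-trans    : ∀ a b c → ¬ ¬ (a ≈ b) → ¬ ¬ (b ≈ c) → ¬ ¬ (a ≈ c)
    rel-cong   : ∀ R (as bs : Vector Carrier (relArity L R)) →
                 (∀ i → ¬ ¬ (as i ≈ bs i)) → ¬ ¬ relᴹ R as → ¬ ¬ relᴹ R bs
    graph-cong : ∀ f (as bs : Vector Carrier (funArity L f)) a b →
                 (∀ i → ¬ ¬ (as i ≈ bs i)) → ¬ ¬ (a ≈ b) →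
                 ¬ ¬ graphᴹ f as a → ¬ ¬ graphᴹ f bs b
    graph-total      : ∀ f (as : Vector Carrier (funArity L f)) →
                       ¬ ¬ (Σ[ b ∈ Carrier ] graphᴹ f as b)
    graph-functional : ∀ f (as : Vector Carrier (funArity L f)) a b →
                       ¬ ¬ graphᴹ f as a → ¬ ¬ graphᴹ f as b → ¬ ¬ (a ≈ b)

module _ {L : Signature} (M : Structure L) where
  open Structure M

  Val : ∀ {n} → Term L n → Vector Carrier n → Carrier → Set
  Val (var i)    e a = e i ≈ a
  Val (app f ts) e a =
    Σ[ bs ∈ Vector Carrier (funArity L f) ]
      ((∀ i → Val (ts i) e (bs i)) × graphᴹ f bs a)

  Sat : ∀ {n} → Formula L n → Vector Carrier n → Set
  Sat ⊥'         e = ⊥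
  Sat (t ≐ s)    e = ¬ ¬ (Σ[ a ∈ Carrier ] Σ[ b ∈ Carrier ]
                           (Val t e a × Val s e b × a ≈ b))
  Sat (rel R ts) e = ¬ ¬ (Σ[ bs ∈ Vector Carrier (relArity L R) ]
                           ((∀ i → Val (ts i) e (bs i)) × relᴹ R bs))
  Sat (φ ⇒ ψ)    e = Sat φ e → Sat ψ e
  Sat (∀' φ)     e = (a : Carrier) → Sat φ (a ∷ e)

_⊨ᵀ_ : {L : Signature} → Structure L → Theory L → Set
M ⊨ᵀ T = IsWellFormed M × (∀ σ → T σ → Sat M σ [])

-- T proves σ (semantic consequence; equivalent to provability by completeness)
_⊢_ : {L : Signature} → Theory L → Sentence L → Set₁
T ⊢ σ = ∀ M → M ⊨ᵀ T → Sat M σ []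

record IsIsomorphism {L : Signature} (A B : Structure L)
                     (r : ∣ A ∣ → ∣ B ∣ → Set) : Set where
  field
    total       : ∀ a → ¬ ¬ (Σ[ b ∈ ∣ B ∣ ] r a b)
    surjective  : ∀ b → ¬ ¬ (Σ[ a ∈ ∣ A ∣ ] r a b)
    respects-≈  : ∀ a a' b b' → r a b → r a' b' →
                  (¬ ¬ (Structure._≈_ A a a') → ¬ ¬ (Structure._≈_ B b b')) ×
                  (¬ ¬ (Structure._≈_ B b b') → ¬ ¬ (Structure._≈_ A a a'))
    respects-rel : ∀ R (as : Vector ∣ A ∣ (relArity L R))
                     (bs : Vector ∣ B ∣ (relArity L R)) →
                   (∀ i → r (as i) (bs i)) →
                   (¬ ¬ Structure.relᴹ A R as → ¬ ¬ Structure.relᴹ B R bs) ×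
                   (¬ ¬ Structure.relᴹ B R bs → ¬ ¬ Structure.relᴹ A R as)
    respects-fun : ∀ f (as : Vector ∣ A ∣ (funArity L f))
                     (bs : Vector ∣ B ∣ (funArity L f)) a b →
                   (∀ i → r (as i) (bs i)) → r a b →
                   (¬ ¬ Structure.graphᴹ A f as a → ¬ ¬ Structure.graphᴹ B f bs b) ×
                   (¬ ¬ Structure.graphᴹ B f bs b → ¬ ¬ Structure.graphᴹ A f as a)

-- Variable conventions: the last p variables are the parameters;
--   domain   : x , params
--   equality : x , y , params
--   relation : x₀ … x_{k-1} , params
--   function : y , x₀ … x_{k-1} , params     (graph  f(x̄) = y)

record Interpretation (L₁ L₂ : Signature) (p : ℕ) : Set where
  field
    domain   : Formula L₂ (1 + p)
    equality : Formula L₂ (2 + p)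
    relation : (R : Rel L₁) → Formula L₂ (relArity L₁ R + p)
    function : (f : Fun L₁) → Formula L₂ (suc (funArity L₁ f) + p)

module _ {L₁ L₂ : Signature} {p : ℕ} (I : Interpretation L₁ L₂ p) where
  open Interpretation I

  private
    inst : ∀ {k m} → Formula L₂ (k + p) → Vector (Fin m) k → Vector (Fin m) p →
           Formula L₂ m
    inst φ xs π = renFormula (xs ++ π) φ

  -- 'trTerm t ρ π y' : the translation of "t = y"
  trTerm : ∀ {n m} → Term L₁ n → Vector (Fin m) n → Vector (Fin m) p → Fin m →
           Formula L₂ m
  trTerm {m = m} (var i) ρ π y = inst equality (ρ i ∷ y ∷ []) π
  trTerm {m = m} (app f ts) ρ π y =
    existsN (funArity L₁ f)
      (bigAnd (funArity L₁ f)
         (λ i → inst domain ((i ↑ˡ m) ∷ []) ((funArity L₁ f ↑ʳ_) ∘ π)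
                ∧' trTerm (ts i) ((funArity L₁ f ↑ʳ_) ∘ ρ)
                                 ((funArity L₁ f ↑ʳ_) ∘ π) (i ↑ˡ m))
       ∧' inst (function f) ((funArity L₁ f ↑ʳ y) ∷ (_↑ˡ m))
                            ((funArity L₁ f ↑ʳ_) ∘ π))

  translate : ∀ {n m} → Formula L₁ n → Vector (Fin m) n → Vector (Fin m) p →
              Formula L₂ m
  translate ⊥' ρ π = ⊥'
  translate {m = m} (t ≐ s) ρ π =
    existsN 2
      (inst domain (zero ∷ []) ((2 ↑ʳ_) ∘ π)
       ∧' inst domain (suc zero ∷ []) ((2 ↑ʳ_) ∘ π)
       ∧' trTerm t ((2 ↑ʳ_) ∘ ρ) ((2 ↑ʳ_) ∘ π) zero
       ∧' trTerm s ((2 ↑ʳ_) ∘ ρ) ((2 ↑ʳ_) ∘ π) (suc zero)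
       ∧' inst equality (zero ∷ suc zero ∷ []) ((2 ↑ʳ_) ∘ π))
  translate {m = m} (rel R ts) ρ π =
    existsN (relArity L₁ R)
      (bigAnd (relArity L₁ R)
         (λ i → inst domain ((i ↑ˡ m) ∷ []) ((relArity L₁ R ↑ʳ_) ∘ π)
                ∧' trTerm (ts i) ((relArity L₁ R ↑ʳ_) ∘ ρ)
                                 ((relArity L₁ R ↑ʳ_) ∘ π) (i ↑ˡ m))
       ∧' inst (relation R) (_↑ˡ m) ((relArity L₁ R ↑ʳ_) ∘ π))
  translate (φ ⇒ ψ) ρ π = translate φ ρ π ⇒ translate ψ ρ π
  translate (∀' φ) ρ π =
    ∀' (inst domain (zero ∷ []) (suc ∘ π) ⇒ translate φ (zero ∷ (suc ∘ ρ)) (suc ∘ π))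

  _^ᴵ_ : (M : Structure L₂) → Vector ∣ M ∣ p → Structure L₁
  M ^ᴵ c = record
    { Carrier = Σ[ a ∈ ∣ M ∣ ] Sat M domain ((a ∷ []) ++ c)
    ; _≈_     = λ x y → Sat M equality ((proj₁ x ∷ proj₁ y ∷ []) ++ c)
    ; relᴹ    = λ R as → Sat M (relation R) ((proj₁ ∘ as) ++ c)
    ; graphᴹ  = λ f as b → Sat M (function f) ((proj₁ b ∷ (proj₁ ∘ as)) ++ c)
    }

Translation : Signature → Signature → Set
Translation L₁ L₂ = Interpretation L₁ L₂ 0

_^_ : {L₁ L₂ : Signature} → Structure L₂ → Translation L₁ L₂ → Structure L₁
M ^ I = _^ᴵ_ I M []

translateSentence : {L₁ L₂ : Signature} → Translation L₁ L₂ → Sentence L₁ → Sentence L₂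
translateSentence I σ = translate I σ [] []

IsInterpretation : {L₁ L₂ : Signature} → Translation L₁ L₂ → Theory L₁ → Theory L₂ → Set₁
IsInterpretation I T₁ T₂ =
  (∀ M → M ⊨ᵀ T₂ → IsWellFormed (M ^ I)) ×
  (∀ σ → T₁ σ → T₂ ⊢ translateSentence I σ)

compose : {L₁ L₂ L₃ : Signature} → Translation L₁ L₂ → Translation L₂ L₃ → Translation L₁ L₃
compose I J = record
  { domain   = Interpretation.domain J ∧' translate J (Interpretation.domain I) id []
  ; equality = translate J (Interpretation.equality I) id []
  ; relation = λ R → translate J (Interpretation.relation I R) id []
  ; function = λ f → translate J (Interpretation.function I f) id []
  }

ProvablyIsoToIdentity : {L : Signature} → Translation L L → Theory L → Set₁
ProvablyIsoToIdentity {L} K T =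
  Σ[ ι ∈ Formula L 2 ]
    (∀ M → M ⊨ᵀ T →
       IsIsomorphism (M ^ K) M (λ x b → Sat M ι (proj₁ x ∷ b ∷ [])))

IsRetractTh : {L₁ L₂ : Signature} → Theory L₁ → Theory L₂ → Set₁
IsRetractTh {L₁} {L₂} T₁ T₂ =
  Σ[ I ∈ Translation L₁ L₂ ] Σ[ J ∈ Translation L₂ L₁ ]
    (IsInterpretation I T₁ T₂ × IsInterpretation J T₂ T₁ ×
     ProvablyIsoToIdentity (compose I J) T₁)

BiInterpretable : {L₁ L₂ : Signature} → Theory L₁ → Theory L₂ → Set₁
BiInterpretable {L₁} {L₂} T₁ T₂ =
  Σ[ I ∈ Translation L₁ L₂ ] Σ[ J ∈ Translation L₂ L₁ ]
    (IsInterpretation I T₁ T₂ × IsInterpretation J T₂ T₁ ×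
     ProvablyIsoToIdentity (compose I J) T₁ ×
     ProvablyIsoToIdentity (compose J I) T₂)

IsRetractStr : {L₁ L₂ : Signature} → Structure L₁ → Structure L₂ → Set₁
IsRetractStr {L₁} {L₂} M N =
  Σ[ p ∈ ℕ ] Σ[ 𝖭 ∈ Interpretation L₂ L₁ p ] Σ[ c ∈ Vector ∣ M ∣ p ]
  let MN = _^ᴵ_ 𝖭 M c in
  IsWellFormed MN ×
  (Σ[ r ∈ (∣ MN ∣ → ∣ N ∣ → Set) ] IsIsomorphism MN N r) ×
  (Σ[ q ∈ ℕ ] Σ[ 𝖬 ∈ Interpretation L₁ L₂ q ] Σ[ d ∈ Vector ∣ MN ∣ q ]
   let MNM = _^ᴵ_ 𝖬 MN d in
   IsWellFormed MNM ×
   (Σ[ s ∈ ℕ ] Σ[ ι ∈ Formula L₁ (2 + s) ] Σ[ e ∈ Vector ∣ M ∣ s ]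
      IsIsomorphism M MNM
        (λ a x → Sat M ι ((a ∷ proj₁ (proj₁ x) ∷ []) ++ e))))

RetractDisjoint : (L : ℕ → Signature) → ((k : ℕ) → Theory (L k)) → Set₁
RetractDisjoint L W =
  ∀ k n (M : Structure (L k)) (N : Structure (L n)) →
    M ⊨ᵀ W k → N ⊨ᵀ W n → IsRetractStr M N → k ≡ n

{-# OPTIONS --safe #-}
module Submission where

-- Let (Iₖ, Jₖ) witness the bi-interpretability of Uₖ and Vₖ, and let 𝓜 ⊨ Vₖ be a
-- retract of 𝓝 ⊨ Vₙ.  Since (𝓜^Iₖ)^Jₖ ≅ 𝓜 definably, the Uₖ-model 𝓜^Iₖ is a retract
-- of 𝓜; likewise 𝓝 is a retract of the Uₙ-model 𝓝^Iₙ.  Retracts compose (compose the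
-- interpretations, carrying the parameters along, and check that the composite
-- isomorphism is still definable), so 𝓜^Iₖ is a retract of 𝓝^Iₙ and k = n by
-- retract-disjointness of {Uₖ}.  Everything is classical, i.e. proved under double
-- negation, which is harmless in the end because equality on ℕ is decidable.

open import Defs
open import Level using (Level)
open import Data.Nat using (ℕ; zero; suc; _+_; _≟_)
open import Data.Fin using (Fin; zero; suc; _↑ˡ_; _↑ʳ_; splitAt)
open import Data.Vec.Functional using (Vector; []; _∷_; _++_; head; tail)
open import Data.Vec.Functional.Properties using (lookup-++ˡ; lookup-++ʳ)
open import Data.Vec.Functional.Relation.Binary.Pointwise.Properties using (++⁺)
open import Data.Product using (Σ; Σ-syntax; _×_; _,_; proj₁; proj₂; swap)
open import Data.Sum using (inj₁; inj₂)
open import Function using (_∘_; id; _⇔_; mk⇔; Equivalence)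
open import Function.Construct.Composition using (_⇔-∘_)
open import Function.Construct.Identity using (⇔-id)
open import Data.Product.Function.NonDependent.Propositional using (_×-⇔_)
open import Relation.Nullary using (¬_; Stable; ¬¬-map)
open import Relation.Nullary.Decidable using (decidable-stable)
open import Relation.Binary.PropositionalEquality using (_≡_; _≗_; refl; sym; trans; cong; subst)

open Equivalence using (to; from)
open IsIsomorphism

private
  variable
    a b ℓ : Level
    A : Set a
    B : Set b

return : A → ¬ ¬ A
return x k = k x

_>>=_ : ¬ ¬ A → (A → ¬ ¬ B) → ¬ ¬ B
(m >>= f) k = m (λ x → f x k)

¬¬-Π-Fin : ∀ k {P : Fin k → Set ℓ} → (∀ i → ¬ ¬ P i) → ¬ ¬ (∀ i → P i)
¬¬-Π-Fin zero    h = return (λ ())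
¬¬-Π-Fin (suc k) h = do
  p₀ ← h zero
  ps ← ¬¬-Π-Fin k (h ∘ suc)
  return λ { zero → p₀ ; (suc i) → ps i }

¬¬-choice-Fin : ∀ k {R : Fin k → B → Set ℓ} → (∀ i → ¬ ¬ Σ B (R i)) →
                ¬ ¬ (Σ[ bs ∈ Vector B k ] (∀ i → R i (bs i)))
¬¬-choice-Fin k h = do
  f ← ¬¬-Π-Fin k h
  return ((proj₁ ∘ f) , (proj₂ ∘ f))

++-uncons : ∀ {k n} (xs : Vector A (suc k)) (ys : Vector A n) → xs ++ ys ≗ head xs ∷ (tail xs ++ ys)
++-uncons xs ys zero = refl
++-uncons {k = k} xs ys (suc i) with splitAt k i
... | inj₁ _ = refl
... | inj₂ _ = refl

lookup-++ʳ-∘ : ∀ {k m n} (xs : Vector A k) {ys : Vector A m} {ρ : Vector (Fin m) n} {zs : Vector A n} →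
               (∀ i → ys (ρ i) ≡ zs i) → ∀ i → (xs ++ ys) (k ↑ʳ ρ i) ≡ zs i
lookup-++ʳ-∘ xs {ys} {ρ} h i = trans (lookup-++ʳ xs ys (ρ i)) (h i)

module _ {L : Signature} (M : Structure L) where
  open Structure M

  Sat-stable : ∀ {n} (φ : Formula L n) e → Stable (Sat M φ e)
  Sat-stable ⊥'         e h   = h id
  Sat-stable (t ≐ s)    e h k = h (λ z → z k)
  Sat-stable (rel R ts) e h k = h (λ z → z k)
  Sat-stable (φ ⇒ ψ)    e h x = Sat-stable ψ e (λ k → h (λ f → k (f x)))
  Sat-stable (∀' φ)     e h a = Sat-stable φ (a ∷ e) (λ k → h (λ f → k (f a)))

  Val-rename : ∀ {n m} (t : Term L n) (ρ : Fin n → Fin m) {g : Vector Carrier m} {e : Vector Carrier n} →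
               (∀ i → g (ρ i) ≡ e i) → ∀ a → Val M (renTerm ρ t) g a ⇔ Val M t e a
  Val-rename (var i)    ρ h a = mk⇔ (subst (_≈ a) (h i)) (subst (_≈ a) (sym (h i)))
  Val-rename (app f ts) ρ h a = mk⇔
    (λ (bs , vs , gr) → bs , (λ i → to (Val-rename (ts i) ρ h (bs i)) (vs i)) , gr)
    (λ (bs , vs , gr) → bs , (λ i → from (Val-rename (ts i) ρ h (bs i)) (vs i)) , gr)

  Sat-rename : ∀ {n m} (φ : Formula L n) (ρ : Fin n → Fin m) {g : Vector Carrier m} {e : Vector Carrier n} →
               (∀ i → g (ρ i) ≡ e i) → Sat M (renFormula ρ φ) g ⇔ Sat M φ e
  Sat-rename ⊥'         ρ h = mk⇔ id id
  Sat-rename (t ≐ s)    ρ h = mk⇔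
    (¬¬-map λ (a , b , vt , vs , q) → a , b , to (Val-rename t ρ h a) vt , to (Val-rename s ρ h b) vs , q)
    (¬¬-map λ (a , b , vt , vs , q) → a , b , from (Val-rename t ρ h a) vt , from (Val-rename s ρ h b) vs , q)
  Sat-rename (rel R ts) ρ h = mk⇔
    (¬¬-map λ (bs , vs , r) → bs , (λ i → to (Val-rename (ts i) ρ h (bs i)) (vs i)) , r)
    (¬¬-map λ (bs , vs , r) → bs , (λ i → from (Val-rename (ts i) ρ h (bs i)) (vs i)) , r)
  Sat-rename (φ ⇒ ψ)    ρ h = mk⇔
    (λ f x → to (Sat-rename ψ ρ h) (f (from (Sat-rename φ ρ h) x)))
    (λ f x → from (Sat-rename ψ ρ h) (f (to (Sat-rename φ ρ h) x)))
  Sat-rename (∀' φ)     ρ h = mk⇔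
    (λ f a → to (Sat-rename φ (liftRen {L = L} ρ) (lift a)) (f a))
    (λ f a → from (Sat-rename φ (liftRen {L = L} ρ) (lift a)) (f a))
    where
    lift : ∀ a i → (a ∷ _) (liftRen {L = L} ρ i) ≡ (a ∷ _) i
    lift a zero    = refl
    lift a (suc i) = h i

  Val-cong : ∀ {n} (t : Term L n) {g e : Vector Carrier n} → g ≗ e → ∀ a → Val M t g a → Val M t e a
  Val-cong (var i)    h a v              = subst (_≈ a) (h i) v
  Val-cong (app f ts) h a (bs , vs , gr) = bs , (λ i → Val-cong (ts i) h (bs i) (vs i)) , gr

  Sat-cong : ∀ {n} (φ : Formula L n) {g e : Vector Carrier n} → g ≗ e → Sat M φ g → Sat M φ e
  Sat-cong ⊥'         h x   = x
  Sat-cong (t ≐ s)    h     = ¬¬-map λ (a , b , vt , vs , q) → a , b , Val-cong t h a vt , Val-cong s h b vs , q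
  Sat-cong (rel R ts) h     = ¬¬-map λ (bs , vs , r) → bs , (λ i → Val-cong (ts i) h (bs i) (vs i)) , r
  Sat-cong (φ ⇒ ψ)    h f x = Sat-cong ψ h (f (Sat-cong φ (sym ∘ h) x))
  Sat-cong (∀' φ)     h f a = Sat-cong φ (λ { zero → refl ; (suc i) → h i }) (f a)

  Sat-∧ : ∀ {n} (φ ψ : Formula L n) e → Sat M (φ ∧' ψ) e ⇔ (Sat M φ e × Sat M ψ e)
  Sat-∧ φ ψ e = mk⇔
    (λ h → Sat-stable φ e (λ k → h (λ x _ → k x)) , Sat-stable ψ e (λ k → h (λ _ y → k y)))
    (λ (x , y) f → f x y)

  Sat-∧-⇔ : ∀ {n} (φ ψ : Formula L n) {e} {P : Set a} {Q : Set b} →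
            Sat M φ e ⇔ P → Sat M ψ e ⇔ Q → Sat M (φ ∧' ψ) e ⇔ (P × Q)
  Sat-∧-⇔ φ ψ {e} hφ hψ = (hφ ×-⇔ hψ) ⇔-∘ Sat-∧ φ ψ e

  Sat-∃ : ∀ {n} (φ : Formula L (suc n)) e → Sat M (∃' φ) e ⇔ (¬ ¬ (Σ[ a ∈ Carrier ] Sat M φ (a ∷ e)))
  Sat-∃ φ e = mk⇔ (λ h k → h (λ a s → k (a , s))) (λ h f → h (λ (a , s) → f a s))

  Sat-existsN : ∀ k {m} (φ : Formula L (k + m)) e →
                Sat M (existsN k φ) e ⇔ (¬ ¬ (Σ[ xs ∈ Vector Carrier k ] Sat M φ (xs ++ e)))
  Sat-existsN zero    φ e = mk⇔ (λ s → return ([] , s)) (Sat-stable φ e ∘ ¬¬-map proj₂)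
  Sat-existsN (suc k) φ e = mk⇔
    (λ s → do
      (xs , s′) ← to (Sat-existsN k (∃' φ) e) s
      (x , s″) ← to (Sat-∃ φ (xs ++ e)) s′
      return ((x ∷ xs) , Sat-cong φ (sym ∘ ++-uncons (x ∷ xs) e) s″))
    (λ h → from (Sat-existsN k (∃' φ) e) (¬¬-map (λ (xs , s) →
      tail xs , from (Sat-∃ φ _) (return (head xs , Sat-cong φ (++-uncons xs e) s))) h))

  Sat-bigAnd : ∀ k {m} (φs : Vector (Formula L m) k) e → Sat M (bigAnd k φs) e ⇔ (∀ i → Sat M (φs i) e)
  Sat-bigAnd zero    φs e = mk⇔ (λ _ ()) (λ _ x → x)
  Sat-bigAnd (suc k) φs e = mk⇔
    (λ s → let (s₀ , sₛ) = to (Sat-∧ (φs zero) (bigAnd k (φs ∘ suc)) e) s in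
           λ { zero → s₀ ; (suc i) → to (Sat-bigAnd k (φs ∘ suc) e) sₛ i })
    (λ f → from (Sat-∧ (φs zero) (bigAnd k (φs ∘ suc)) e)
                (f zero , from (Sat-bigAnd k (φs ∘ suc) e) (f ∘ suc)))

module _ {L₁ L₂ : Signature} {p : ℕ} (I : Interpretation L₁ L₂ p) (M : Structure L₂) (c : Vector ∣ M ∣ p) where
  open Interpretation I

  private
    MI : Structure L₁
    MI = _^ᴵ_ I M c

  Sat-inst : ∀ {k m} (φ : Formula L₂ (k + p)) (xs : Vector (Fin m) k) (π : Vector (Fin m) p)
             {g : Vector ∣ M ∣ m} {ys : Vector ∣ M ∣ k} →
             (∀ i → g (xs i) ≡ ys i) → (∀ j → g (π j) ≡ c j) →
             Sat M (renFormula (xs ++ π) φ) g ⇔ Sat M φ (ys ++ c)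
  Sat-inst φ xs π {g} hx hπ = Sat-rename M φ (xs ++ π) (++⁺ (λ i y → g i ≡ y) hx hπ)

  -- The common shape of the translations of f(t̄) = y and of R(t̄).
  Sat-∃-tuple : ∀ {m} k (π : Vector (Fin m) p) (T : Fin k → Formula L₂ (k + m)) (F : Formula L₂ (k + m))
                {g : Vector ∣ M ∣ m} (V : Fin k → ∣ MI ∣ → Set) (P : Vector ∣ M ∣ k → Set) →
                (∀ j → g (π j) ≡ c j) →
                (∀ i xs b → xs i ≡ proj₁ b → Sat M (T i) (xs ++ g) ⇔ (¬ ¬ V i b)) →
                (∀ xs → Sat M F (xs ++ g) ⇔ P xs) →
                Sat M (existsN k (bigAnd k (λ i → renFormula (((i ↑ˡ m) ∷ []) ++ ((k ↑ʳ_) ∘ π)) domain ∧' T i)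
                                  ∧' F)) g
                  ⇔ (¬ ¬ (Σ[ bs ∈ Vector ∣ MI ∣ k ] ((∀ i → V i (bs i)) × P (proj₁ ∘ bs))))
  Sat-∃-tuple {m} k π T F {g} V P hπ hT hF = mk⇔
    (λ s → do
      (xs , sb) ← to (Sat-existsN M k body g) s
      let (sa , sF) = to (Sat-∧ M _ F (xs ++ g)) sb
          conjunct i = to (Sat-∧ M _ (T i) (xs ++ g)) (to (Sat-bigAnd M k _ (xs ++ g)) sa i)
          bs i = xs i , to (in-domain xs i) (proj₁ (conjunct i))
      vs ← ¬¬-Π-Fin k (λ i → to (hT i xs (bs i) refl) (proj₂ (conjunct i)))
      return (bs , vs , to (hF xs) sF))
    (λ h → from (Sat-existsN M k body g) (do
      (bs , vs , pF) ← h
      let xs = proj₁ ∘ bs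
          conjunct i = from (Sat-∧ M _ (T i) (xs ++ g))
                         (from (in-domain xs i) (proj₂ (bs i)) , from (hT i xs (bs i) refl) (return (vs i)))
      return (xs , from (Sat-∧ M _ F (xs ++ g))
                     (from (Sat-bigAnd M k _ (xs ++ g)) conjunct , from (hF xs) pF))))
    where
    body : Formula L₂ (k + m)
    body = bigAnd k (λ i → renFormula (((i ↑ˡ m) ∷ []) ++ ((k ↑ʳ_) ∘ π)) domain ∧' T i) ∧' F
    in-domain : ∀ xs i → Sat M (renFormula (((i ↑ˡ m) ∷ []) ++ ((k ↑ʳ_) ∘ π)) domain) (xs ++ g)
                           ⇔ Sat M domain ((xs i ∷ []) ++ c)
    in-domain xs i = Sat-inst domain _ _ (λ { zero → lookup-++ˡ xs g i }) (lookup-++ʳ-∘ xs hπ)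

  Sat-trTerm : ∀ {n m} (t : Term L₁ n) (ρ : Vector (Fin m) n) (π : Vector (Fin m) p) (y : Fin m)
               {g : Vector ∣ M ∣ m} {e : Vector ∣ MI ∣ n} (a : ∣ MI ∣) →
               (∀ i → g (ρ i) ≡ proj₁ (e i)) → (∀ j → g (π j) ≡ c j) → g y ≡ proj₁ a →
               Sat M (trTerm I t ρ π y) g ⇔ (¬ ¬ Val MI t e a)
  Sat-trTerm (var i) ρ π y {g} {e} a hρ hπ hy =
    mk⇔ (return ∘ to equal) (from equal ∘ Sat-stable M equality _)
    where
    equal : Sat M (renFormula ((ρ i ∷ y ∷ []) ++ π) equality) g
            ⇔ Sat M equality ((proj₁ (e i) ∷ proj₁ a ∷ []) ++ c)
    equal = Sat-inst equality (ρ i ∷ y ∷ []) π (λ { zero → hρ i ; (suc zero) → hy }) hπ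
  Sat-trTerm (app f ts) ρ π y {g} {e} a hρ hπ hy =
    Sat-∃-tuple (funArity L₁ f) π _ _ (λ i → Val MI (ts i) e)
      (λ xs → Sat M (function f) ((proj₁ a ∷ xs) ++ c)) hπ
      (λ i xs b hb → Sat-trTerm (ts i) _ _ _ b (lookup-++ʳ-∘ xs hρ) (lookup-++ʳ-∘ xs hπ)
                       (trans (lookup-++ˡ xs g i) hb))
      (λ xs → Sat-inst (function f) _ _
                (λ { zero → trans (lookup-++ʳ xs g y) hy ; (suc j) → lookup-++ˡ xs g j })
                (lookup-++ʳ-∘ xs hπ))

  Sat-translate : ∀ {n m} (φ : Formula L₁ n) (ρ : Vector (Fin m) n) (π : Vector (Fin m) p)
                  {g : Vector ∣ M ∣ m} {e : Vector ∣ MI ∣ n} →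
                  (∀ i → g (ρ i) ≡ proj₁ (e i)) → (∀ j → g (π j) ≡ c j) →
                  Sat M (translate I φ ρ π) g ⇔ Sat MI φ e
  Sat-translate ⊥' ρ π hρ hπ = mk⇔ id id
  Sat-translate {n} {m} (t ≐ s) ρ π {g} {e} hρ hπ = mk⇔
    (λ sat → do
      (xs , sb) ← to (Sat-existsN M 2 body g) sat
      let (d₀ , d₁ , sₜ , sₛ , q) = to (conjuncts xs) sb
          a = xs zero , d₀
          b = xs (suc zero) , d₁
      vₜ ← to (Sat-trTerm t _ _ zero a hρ hπ refl) sₜ
      vₛ ← to (Sat-trTerm s _ _ (suc zero) b hρ hπ refl) sₛ
      return (a , b , vₜ , vₛ , q))
    (λ sat → from (Sat-existsN M 2 body g) (do
      (a , b , vₜ , vₛ , q) ← sat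
      let xs = proj₁ a ∷ proj₁ b ∷ []
      return (xs , from (conjuncts xs)
        ( proj₂ a , proj₂ b
        , from (Sat-trTerm t _ _ zero a hρ hπ refl) (return vₜ)
        , from (Sat-trTerm s _ _ (suc zero) b hρ hπ refl) (return vₛ)
        , q))))
    where
    π₂ : Vector (Fin (2 + m)) p
    π₂ = (2 ↑ʳ_) ∘ π
    ρ₂ : Vector (Fin (2 + m)) n
    ρ₂ = (2 ↑ʳ_) ∘ ρ
    D₀ D₁ Tₜ Tₛ E : Formula L₂ (2 + m)
    D₀ = renFormula ((zero ∷ []) ++ π₂) domain
    D₁ = renFormula ((suc zero ∷ []) ++ π₂) domain
    Tₜ = trTerm I t ρ₂ π₂ zero
    Tₛ = trTerm I s ρ₂ π₂ (suc zero)
    E  = renFormula ((zero ∷ suc zero ∷ []) ++ π₂) equality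
    body : Formula L₂ (2 + m)
    body = D₀ ∧' D₁ ∧' Tₜ ∧' Tₛ ∧' E
    conjuncts : (xs : Vector ∣ M ∣ 2) →
      Sat M body (xs ++ g)
      ⇔ (Sat M domain ((xs zero ∷ []) ++ c) × Sat M domain ((xs (suc zero) ∷ []) ++ c)
         × Sat M Tₜ (xs ++ g) × Sat M Tₛ (xs ++ g)
         × Sat M equality ((xs zero ∷ xs (suc zero) ∷ []) ++ c))
    conjuncts xs =
      Sat-∧-⇔ M D₀ (D₁ ∧' Tₜ ∧' Tₛ ∧' E) (Sat-inst domain _ π₂ {g = xs ++ g} (λ { zero → refl }) hπ)
        (Sat-∧-⇔ M D₁ (Tₜ ∧' Tₛ ∧' E) (Sat-inst domain _ π₂ {g = xs ++ g} (λ { zero → refl }) hπ)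
          (Sat-∧-⇔ M Tₜ (Tₛ ∧' E) (⇔-id _)
            (Sat-∧-⇔ M Tₛ E (⇔-id _)
              (Sat-inst equality _ π₂ {g = xs ++ g} (λ { zero → refl ; (suc zero) → refl }) hπ))))
  Sat-translate (rel R ts) ρ π {g} {e} hρ hπ =
    Sat-∃-tuple (relArity L₁ R) π _ _ (λ i → Val MI (ts i) e) (λ xs → Sat M (relation R) (xs ++ c)) hπ
      (λ i xs b hb → Sat-trTerm (ts i) _ _ _ b (lookup-++ʳ-∘ xs hρ) (lookup-++ʳ-∘ xs hπ)
                       (trans (lookup-++ˡ xs g i) hb))
      (λ xs → Sat-inst (relation R) _ _ (lookup-++ˡ xs g) (lookup-++ʳ-∘ xs hπ))
  Sat-translate (φ ⇒ ψ) ρ π hρ hπ = mk⇔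
    (λ f → to (Sat-translate ψ ρ π hρ hπ) ∘ f ∘ from (Sat-translate φ ρ π hρ hπ))
    (λ f → from (Sat-translate ψ ρ π hρ hπ) ∘ f ∘ to (Sat-translate φ ρ π hρ hπ))
  Sat-translate (∀' φ) ρ π {g} {e} hρ hπ = mk⇔
    (λ f (a , d) → to (body a d) (f a (from (in-domain a) d)))
    (λ f a d → from (body a (to (in-domain a) d)) (f (a , to (in-domain a) d)))
    where
    in-domain : ∀ a → Sat M (renFormula ((zero ∷ []) ++ (suc ∘ π)) domain) (a ∷ g)
                      ⇔ Sat M domain ((a ∷ []) ++ c)
    in-domain a = Sat-inst domain _ _ (λ { zero → refl }) hπ
    body : ∀ a (d : Sat M domain ((a ∷ []) ++ c)) →
           Sat M (translate I φ (zero ∷ (suc ∘ ρ)) (suc ∘ π)) (a ∷ g) ⇔ Sat MI φ ((a , d) ∷ e)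
    body a d = Sat-translate φ _ _ (λ { zero → refl ; (suc i) → hρ i }) hπ

^-preserves-⊨ : ∀ {L₁ L₂} {I : Translation L₁ L₂} {T₁ : Theory L₁} {T₂ : Theory L₂} →
                IsInterpretation I T₁ T₂ → ∀ M → M ⊨ᵀ T₂ → (M ^ I) ⊨ᵀ T₁
^-preserves-⊨ {I = I} (wf , axioms) M M⊨T₂ =
  wf M M⊨T₂ , λ σ σ∈T₁ → to (Sat-translate I M [] σ [] [] (λ ()) (λ ())) (axioms σ σ∈T₁ M M⊨T₂)

module _ {L : Signature} where

  iso-sym : {A B : Structure L} {r : ∣ A ∣ → ∣ B ∣ → Set} → IsIsomorphism A B r → IsIsomorphism B A (λ b a → r a b)
  iso-sym i .total = surjective i
  iso-sym i .surjective = total i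
  iso-sym i .respects-≈ b b' a a' rab ra'b' = swap (respects-≈ i a a' b b' rab ra'b')
  iso-sym i .respects-rel R bs as h = swap (respects-rel i R as bs h)
  iso-sym i .respects-fun f bs as b a h rab = swap (respects-fun i f as bs a b h rab)

  iso-trans : {A B C : Structure L} {r : ∣ A ∣ → ∣ B ∣ → Set} {s : ∣ B ∣ → ∣ C ∣ → Set} →
              IsIsomorphism A B r → IsIsomorphism B C s →
              IsIsomorphism A C (λ a c → ¬ ¬ (Σ[ b ∈ ∣ B ∣ ] (r a b × s b c)))
  iso-trans i j .total a = do
    (b , rab) ← total i a
    (c , sbc) ← total j b
    return (c , return (b , rab , sbc))
  iso-trans i j .surjective c = do
    (b , sbc) ← surjective j c
    (a , rab) ← surjective i b
    return (a , return (b , rab , sbc))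
  iso-trans i j .respects-≈ a a' c c' h h' =
    (λ q → do
      (b , rab , sbc) ← h
      (b' , rab' , sbc') ← h'
      proj₁ (respects-≈ j b b' c c' sbc sbc') (proj₁ (respects-≈ i a a' b b' rab rab') q)) ,
    (λ q → do
      (b , rab , sbc) ← h
      (b' , rab' , sbc') ← h'
      proj₂ (respects-≈ i a a' b b' rab rab') (proj₂ (respects-≈ j b b' c c' sbc sbc') q))
  iso-trans i j .respects-rel R as cs h =
    (λ q → do
      (bs , hs) ← ¬¬-choice-Fin (relArity L R) h
      proj₁ (respects-rel j R bs cs (proj₂ ∘ hs)) (proj₁ (respects-rel i R as bs (proj₁ ∘ hs)) q)) ,
    (λ q → do
      (bs , hs) ← ¬¬-choice-Fin (relArity L R) h
      proj₂ (respects-rel i R as bs (proj₁ ∘ hs)) (proj₂ (respects-rel j R bs cs (proj₂ ∘ hs)) q))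
  iso-trans i j .respects-fun f as cs a c h hac =
    (λ q → do
      (bs , hs) ← ¬¬-choice-Fin (funArity L f) h
      (b , rab , sbc) ← hac
      proj₁ (respects-fun j f bs cs b c (proj₂ ∘ hs) sbc)
        (proj₁ (respects-fun i f as bs a b (proj₁ ∘ hs) rab) q)) ,
    (λ q → do
      (bs , hs) ← ¬¬-choice-Fin (funArity L f) h
      (b , rab , sbc) ← hac
      proj₂ (respects-fun i f as bs a b (proj₁ ∘ hs) rab)
        (proj₂ (respects-fun j f bs cs b c (proj₂ ∘ hs) sbc) q))

  iso-cong : {A B : Structure L} {r r' : ∣ A ∣ → ∣ B ∣ → Set} → IsIsomorphism A B r →
             (∀ a b → r a b → r' a b) → (∀ a b → r' a b → ¬ ¬ r a b) → IsIsomorphism A B r'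
  iso-cong i f g .total a = ¬¬-map (λ (b , rab) → b , f a b rab) (total i a)
  iso-cong i f g .surjective b = ¬¬-map (λ (a , rab) → a , f a b rab) (surjective i b)
  iso-cong i f g .respects-≈ a a' b b' h h' =
    (λ q → do r₁ ← g a b h ; r₂ ← g a' b' h' ; proj₁ (respects-≈ i a a' b b' r₁ r₂) q) ,
    (λ q → do r₁ ← g a b h ; r₂ ← g a' b' h' ; proj₂ (respects-≈ i a a' b b' r₁ r₂) q)
  iso-cong i f g .respects-rel R as bs h =
    (λ q → do
      hs ← ¬¬-Π-Fin (relArity L R) (λ k → g (as k) (bs k) (h k))
      proj₁ (respects-rel i R as bs hs) q) ,
    (λ q → do
      hs ← ¬¬-Π-Fin (relArity L R) (λ k → g (as k) (bs k) (h k))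
      proj₂ (respects-rel i R as bs hs) q)
  iso-cong i f g .respects-fun fn as bs a b h hab =
    (λ q → do
      hs ← ¬¬-Π-Fin (funArity L fn) (λ k → g (as k) (bs k) (h k))
      r₁ ← g a b hab
      proj₁ (respects-fun i fn as bs a b hs r₁) q) ,
    (λ q → do
      hs ← ¬¬-Π-Fin (funArity L fn) (λ k → g (as k) (bs k) (h k))
      r₁ ← g a b hab
      proj₂ (respects-fun i fn as bs a b hs r₁) q)

  Val-iso : {A B : Structure L} {r : ∣ A ∣ → ∣ B ∣ → Set} → IsIsomorphism A B r →
            ∀ {n} (t : Term L n) {eA eB} → (∀ i → r (eA i) (eB i)) → ∀ a b → r a b →
            Val A t eA a → ¬ ¬ Val B t eB b
  Val-iso i (var x) {eA} {eB} h a b rab v = proj₁ (respects-≈ i (eA x) a (eB x) b (h x) rab) (return v)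
  Val-iso i (app f ts) h a b rab (as , vs , gr) = do
    (bs , rs) ← ¬¬-choice-Fin (funArity L f) (λ k → total i (as k))
    vs' ← ¬¬-Π-Fin (funArity L f) (λ k → Val-iso i (ts k) h (as k) (bs k) (rs k) (vs k))
    gr' ← proj₁ (respects-fun i f as bs a b rs rab) (return gr)
    return (bs , vs' , gr')

  Sat-iso : {A B : Structure L} {r : ∣ A ∣ → ∣ B ∣ → Set} → IsIsomorphism A B r →
            ∀ {n} (φ : Formula L n) {eA eB} → (∀ i → r (eA i) (eB i)) → Sat A φ eA → Sat B φ eB
  Sat-iso i ⊥' h x = x
  Sat-iso i (t ≐ s) h sat = do
    (a , b , vt , vs , q) ← sat
    (a' , ra) ← total i a
    (b' , rb) ← total i b
    vt' ← Val-iso i t h a a' ra vt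
    vs' ← Val-iso i s h b b' rb vs
    q' ← proj₁ (respects-≈ i a b a' b' ra rb) (return q)
    return (a' , b' , vt' , vs' , q')
  Sat-iso i (rel R ts) h sat = do
    (as , vs , rl) ← sat
    (bs , rs) ← ¬¬-choice-Fin (relArity L R) (λ k → total i (as k))
    vs' ← ¬¬-Π-Fin (relArity L R) (λ k → Val-iso i (ts k) h (as k) (bs k) (rs k) (vs k))
    rl' ← proj₁ (respects-rel i R as bs rs) (return rl)
    return (bs , vs' , rl')
  Sat-iso i (φ ⇒ ψ) h f = Sat-iso i ψ h ∘ f ∘ Sat-iso (iso-sym i) φ h
  Sat-iso {B = B} i (∀' φ) {eB = eB} h f b = Sat-stable B φ (b ∷ eB) (do
    (a , rab) ← surjective i b
    return (Sat-iso i φ (λ { zero → rab ; (suc k) → h k }) (f a)))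

  wellFormed-iso : {A B : Structure L} {r : ∣ A ∣ → ∣ B ∣ → Set} → IsIsomorphism A B r →
                   IsWellFormed B → IsWellFormed A
  wellFormed-iso {A} {B} {r} i wf = record
    { nonempty = λ k → W.nonempty (λ b → surjective i b (λ (a , _) → k a))
    ; ≈-refl = λ a → do
        (b , rab) ← total i a
        ≈-back rab rab (W.≈-refl b)
    ; ≈-sym = λ a a' q → do
        (b , ra) ← total i a
        (b' , ra') ← total i a'
        ≈-back ra' ra (W.≈-sym b b' (≈-forth ra ra' q))
    ; ≈-trans = λ a a' a'' q q' → do
        (b , ra) ← total i a
        (b' , ra') ← total i a'
        (b'' , ra'') ← total i a''
        ≈-back ra ra'' (W.≈-trans b b' b'' (≈-forth ra ra' q) (≈-forth ra' ra'' q'))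
    ; rel-cong = λ R as as' h q → do
        (bs , rs) ← image (relArity L R) as
        (bs' , rs') ← image (relArity L R) as'
        proj₂ (respects-rel i R as' bs' rs')
          (W.rel-cong R bs bs' (λ k → ≈-forth (rs k) (rs' k) (h k)) (proj₁ (respects-rel i R as bs rs) q))
    ; graph-cong = λ f as as' a a' h ha q → do
        (bs , rs) ← image (funArity L f) as
        (bs' , rs') ← image (funArity L f) as'
        (b , rb) ← total i a
        (b' , rb') ← total i a'
        proj₂ (respects-fun i f as' bs' a' b' rs' rb')
          (W.graph-cong f bs bs' b b' (λ k → ≈-forth (rs k) (rs' k) (h k)) (≈-forth rb rb' ha)
             (proj₁ (respects-fun i f as bs a b rs rb) q))
    ; graph-total = λ f as → do
        (bs , rs) ← image (funArity L f) as
        (b , gb) ← W.graph-total f bs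
        (a , ra) ← surjective i b
        ga ← proj₂ (respects-fun i f as bs a b rs ra) (return gb)
        return (a , ga)
    ; graph-functional = λ f as a a' q q' → do
        (bs , rs) ← image (funArity L f) as
        (b , rb) ← total i a
        (b' , rb') ← total i a'
        ≈-back rb rb' (W.graph-functional f bs b b' (proj₁ (respects-fun i f as bs a b rs rb) q)
                                                    (proj₁ (respects-fun i f as bs a' b' rs rb') q'))
    }
    where
    module W = IsWellFormed wf
    image : ∀ k (as : Vector ∣ A ∣ k) → ¬ ¬ (Σ[ bs ∈ Vector ∣ B ∣ k ] (∀ j → r (as j) (bs j)))
    image k as = ¬¬-choice-Fin k (total i ∘ as)
    ≈-forth : ∀ {a a' b b'} → r a b → r a' b' →
              ¬ ¬ (Structure._≈_ A a a') → ¬ ¬ (Structure._≈_ B b b')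
    ≈-forth ra ra' = proj₁ (respects-≈ i _ _ _ _ ra ra')
    ≈-back : ∀ {a a' b b'} → r a b → r a' b' →
             ¬ ¬ (Structure._≈_ B b b') → ¬ ¬ (Structure._≈_ A a a')
    ≈-back ra ra' = proj₂ (respects-≈ i _ _ _ _ ra ra')

module _ {L₁ L₂ : Signature} {p : ℕ} (K : Interpretation L₁ L₂ p) where
  open Interpretation K

  iso-^ᴵ : {A B : Structure L₂} {r : ∣ A ∣ → ∣ B ∣ → Set} → IsIsomorphism A B r →
           (cA : Vector ∣ A ∣ p) (cB : Vector ∣ B ∣ p) → (∀ j → r (cA j) (cB j)) →
           IsIsomorphism (_^ᴵ_ K A cA) (_^ᴵ_ K B cB) (λ x y → r (proj₁ x) (proj₁ y))
  iso-^ᴵ {A} {B} {r} i cA cB hc = record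
    { total = λ (a , da) → do
        (b , rab) ← total i a
        return ((b , forth domain (λ { zero → rab }) da) , rab)
    ; surjective = λ (b , db) → do
        (a , rab) ← surjective i b
        return ((a , back domain (λ { zero → rab }) db) , rab)
    ; respects-≈ = λ x x' y y' h h' →
        ¬¬-map (forth equality (λ { zero → h ; (suc zero) → h' })) ,
        ¬¬-map (back equality (λ { zero → h ; (suc zero) → h' }))
    ; respects-rel = λ R as bs h → ¬¬-map (forth (relation R) h) , ¬¬-map (back (relation R) h)
    ; respects-fun = λ f as bs a b h hab →
        ¬¬-map (forth (function f) (λ { zero → hab ; (suc k) → h k })) ,
        ¬¬-map (back (function f) (λ { zero → hab ; (suc k) → h k }))
    }
    where
    forth : ∀ {k} (φ : Formula L₂ (k + p)) {xs ys} → (∀ j → r (xs j) (ys j)) →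
            Sat A φ (xs ++ cA) → Sat B φ (ys ++ cB)
    forth φ h = Sat-iso i φ (++⁺ r h hc)
    back : ∀ {k} (φ : Formula L₂ (k + p)) {xs ys} → (∀ j → r (xs j) (ys j)) →
           Sat B φ (ys ++ cB) → Sat A φ (xs ++ cA)
    back φ h = Sat-iso (iso-sym i) φ (++⁺ (λ y x → r x y) h hc)

  iso-refl-^ᴵ : (X : Structure L₂) (c : Vector ∣ X ∣ p) →
                IsIsomorphism (_^ᴵ_ K X c) (_^ᴵ_ K X c) (λ x y → proj₁ x ≡ proj₁ y)
  iso-refl-^ᴵ X c = record
    { total = λ x → return (x , refl)
    ; surjective = λ x → return (x , refl)
    ; respects-≈ = λ x x' y y' h h' →
        ¬¬-map (cong-params equality (λ { zero → h ; (suc zero) → h' })) ,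
        ¬¬-map (cong-params equality (λ { zero → sym h ; (suc zero) → sym h' }))
    ; respects-rel = λ R as bs h →
        ¬¬-map (cong-params (relation R) h) , ¬¬-map (cong-params (relation R) (sym ∘ h))
    ; respects-fun = λ f as bs a b h hab →
        ¬¬-map (cong-params (function f) (λ { zero → hab ; (suc i) → h i })) ,
        ¬¬-map (cong-params (function f) (λ { zero → sym hab ; (suc i) → sym (h i) }))
    }
    where
    cong-params : ∀ {k} (φ : Formula L₂ (k + p)) {xs ys : Vector ∣ X ∣ k} → xs ≗ ys →
                  Sat X φ (xs ++ c) → Sat X φ (ys ++ c)
    cong-params φ h = Sat-cong X φ (++⁺ _≡_ h (λ _ → refl))

module Flattening {L₁ L₂ L₃ : Signature} {p q r : ℕ}
  (K : Interpretation L₂ L₃ p) (P : Interpretation L₁ L₂ q) (C : Interpretation L₁ L₃ r)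
  (X : Structure L₃) (c : Vector ∣ X ∣ p) (d : Vector ∣ _^ᴵ_ K X c ∣ q) (c* : Vector ∣ X ∣ r) where

  private
    module K = Interpretation K
    module P = Interpretation P
    module C = Interpretation C
    Y : Structure L₂
    Y = _^ᴵ_ K X c

  DefinesSame : ∀ k → Formula L₃ (k + r) → Formula L₂ (k + q) → Set
  DefinesSame k φC φP = ∀ (xs : Vector ∣ X ∣ k) (ys : Vector ∣ Y ∣ k) → (∀ i → xs i ≡ proj₁ (ys i)) →
                        Sat X φC (xs ++ c*) ⇔ Sat Y φP (ys ++ d)

  PlacesParameters : ∀ k → Vector (Fin (k + r)) (k + q) → Vector (Fin (k + r)) p → Set
  PlacesParameters k ρ π =
    ∀ (xs : Vector ∣ X ∣ k) (ys : Vector ∣ Y ∣ k) → (∀ i → xs i ≡ proj₁ (ys i)) →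
    (∀ i → (xs ++ c*) (ρ i) ≡ proj₁ ((ys ++ d) i)) × (∀ j → (xs ++ c*) (π j) ≡ c j)

  translate-definesSame : ∀ k (φ : Formula L₂ (k + q)) ρ π → PlacesParameters k ρ π →
                          DefinesSame k (translate K φ ρ π) φ
  translate-definesSame k φ ρ π places xs ys h =
    Sat-translate K X c φ ρ π (proj₁ (places xs ys h)) (proj₂ (places xs ys h))

  Sat-∧-translate-domain :
    (D : Formula L₃ (1 + r)) (ρ : Vector (Fin (1 + r)) (1 + q)) (π : Vector (Fin (1 + r)) p) →
    PlacesParameters 1 ρ π → (∀ a → Sat X D ((a ∷ []) ++ c*) ⇔ Sat X K.domain ((a ∷ []) ++ c)) →
    ∀ a → Sat X (D ∧' translate K P.domain ρ π) ((a ∷ []) ++ c*)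
          ⇔ (Σ[ dK ∈ Sat X K.domain ((a ∷ []) ++ c) ] Sat Y P.domain (((a , dK) ∷ []) ++ d))
  Sat-∧-translate-domain D ρ π places same-D a = mk⇔
    (λ s → let (sD , sP) = to (Sat-∧ X D _ _) s
               dK = to (same-D a) sD
           in dK , to (same-P dK) sP)
    (λ (dK , dP) → from (Sat-∧ X D _ _) (from (same-D a) dK , from (same-P dK) dP))
    where
    same-P : ∀ dK → Sat X (translate K P.domain ρ π) ((a ∷ []) ++ c*)
                    ⇔ Sat Y P.domain (((a , dK) ∷ []) ++ d)
    same-P dK = translate-definesSame 1 P.domain ρ π places (a ∷ []) ((a , dK) ∷ []) (λ { zero → refl })

  iso-flatten : (∀ a → Sat X C.domain ((a ∷ []) ++ c*)
                       ⇔ (Σ[ dK ∈ Sat X K.domain ((a ∷ []) ++ c) ]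
                            Sat Y P.domain (((a , dK) ∷ []) ++ d))) →
                DefinesSame 2 C.equality P.equality →
                (∀ R → DefinesSame (relArity L₁ R) (C.relation R) (P.relation R)) →
                (∀ f → DefinesSame (suc (funArity L₁ f)) (C.function f) (P.function f)) →
                IsIsomorphism (_^ᴵ_ C X c*) (_^ᴵ_ P Y d) (λ x z → proj₁ x ≡ proj₁ (proj₁ z))
  iso-flatten same-domain same-≈ same-rel same-fun = record
    { total = λ (a , da) → let (dK , dP) = to (same-domain a) da in return (((a , dK) , dP) , refl)
    ; surjective = λ ((a , dK) , dP) → return ((a , from (same-domain a) (dK , dP)) , refl)
    ; respects-≈ = λ x x' z z' h h' →
        both (same-≈ _ (proj₁ z ∷ proj₁ z' ∷ []) (λ { zero → h ; (suc zero) → h' }))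
    ; respects-rel = λ R as zs h → both (same-rel R _ (proj₁ ∘ zs) h)
    ; respects-fun = λ f as zs a z h hz →
        both (same-fun f _ (proj₁ z ∷ (proj₁ ∘ zs)) (λ { zero → hz ; (suc k) → h k }))
    }
    where
    both : ∀ {A B : Set} → A ⇔ B → (¬ ¬ A → ¬ ¬ B) × (¬ ¬ B → ¬ ¬ A)
    both e = ¬¬-map (to e) , ¬¬-map (from e)

module _ {L₁ L₂ L₃ : Signature} {q p : ℕ} (P : Interpretation L₁ L₂ q) (K : Interpretation L₂ L₃ p) where
  private
    module K = Interpretation K
    module P = Interpretation P

    inner-vars : ∀ k → Vector (Fin (k + (q + p))) (k + q)
    inner-vars k = (λ (i : Fin k) → i ↑ˡ (q + p)) ++ (λ i → k ↑ʳ (i ↑ˡ p))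

    outer-params : ∀ k → Vector (Fin (k + (q + p))) p
    outer-params k j = k ↑ʳ (q ↑ʳ j)

    under-K : ∀ k → Formula L₂ (k + q) → Formula L₃ (k + (q + p))
    under-K k φ = translate K φ (inner-vars k) (outer-params k)

  -- The parameters of P come first, followed by those of K.
  composeᴵ : Interpretation L₁ L₃ (q + p)
  composeᴵ = record
    { domain   = renFormula ((λ (i : Fin 1) → i ↑ˡ (q + p)) ++ outer-params 1) K.domain
                 ∧' under-K 1 P.domain
    ; equality = under-K 2 P.equality
    ; relation = λ R → under-K (relArity L₁ R) (P.relation R)
    ; function = λ f → under-K (suc (funArity L₁ f)) (P.function f)
    }

  ^ᴵ-composeᴵ : (X : Structure L₃) (c : Vector ∣ X ∣ p) (d : Vector ∣ _^ᴵ_ K X c ∣ q) →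
                IsIsomorphism (_^ᴵ_ composeᴵ X ((proj₁ ∘ d) ++ c)) (_^ᴵ_ P (_^ᴵ_ K X c) d)
                              (λ x z → proj₁ x ≡ proj₁ (proj₁ z))
  ^ᴵ-composeᴵ X c d =
    iso-flatten
      (Sat-∧-translate-domain _ _ _ (places 1)
         (λ a → Sat-inst K X c K.domain _ _ {g = (a ∷ []) ++ c*}
                  (λ { zero → refl }) (outer-fit (a ∷ []))))
      (translate-definesSame 2 P.equality _ _ (places 2))
      (λ R → translate-definesSame _ (P.relation R) _ _ (places (relArity L₁ R)))
      (λ f → translate-definesSame _ (P.function f) _ _ (places (suc (funArity L₁ f))))
    where
    c* : Vector ∣ X ∣ (q + p)
    c* = (proj₁ ∘ d) ++ c
    open Flattening K P composeᴵ X c d c*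
    outer-fit : ∀ {k} (xs : Vector ∣ X ∣ k) j → (xs ++ c*) (outer-params k j) ≡ c j
    outer-fit xs j = trans (lookup-++ʳ xs c* (q ↑ʳ j)) (lookup-++ʳ (proj₁ ∘ d) c j)
    places : ∀ k → PlacesParameters k (inner-vars k) (outer-params k)
    places k xs ys h =
      ++⁺ (λ i y → (xs ++ c*) i ≡ proj₁ y) {m = k}
        (λ i → trans (lookup-++ˡ xs c* i) (h i))
        (λ j → trans (lookup-++ʳ xs c* (j ↑ˡ p)) (lookup-++ˡ (proj₁ ∘ d) c j)) ,
      outer-fit xs

^-compose : ∀ {L₁ L₂ L₃} (P : Translation L₁ L₂) (K : Translation L₂ L₃) (X : Structure L₃) →
            IsIsomorphism (X ^ compose P K) ((X ^ K) ^ P) (λ x z → proj₁ x ≡ proj₁ (proj₁ z))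
^-compose {L₁} P K X =
  iso-flatten
    (Sat-∧-translate-domain K.domain id [] (places 1) (λ a → ⇔-id _))
    (translate-definesSame 2 P.equality id [] (places 2))
    (λ R → translate-definesSame _ (P.relation R) id [] (places (relArity L₁ R)))
    (λ f → translate-definesSame _ (P.function f) id [] (places (suc (funArity L₁ f))))
  where
  module K = Interpretation K
  module P = Interpretation P
  open Flattening K P (compose P K) X [] [] []
  places : ∀ k → PlacesParameters k id []
  places k xs ys h = ++⁺ (λ x y → x ≡ proj₁ y) h (λ ()) , (λ ())

isRetract-^ : ∀ {L₁ L₂} (Y : Structure L₁) (B : Translation L₂ L₁) (A : Translation L₁ L₂) →
              IsWellFormed (Y ^ B) → IsWellFormed ((Y ^ B) ^ A) → (ι : Formula L₁ 2) →
              IsIsomorphism (Y ^ compose A B) Y (λ x y → Sat Y ι (proj₁ x ∷ y ∷ [])) →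
              IsRetractStr Y (Y ^ B)
isRetract-^ {L₁} Y B A wfB wfBA ι YAB≅Y =
  0 , B , [] , wfB , (_ , iso-refl-^ᴵ B Y []) , 0 , A , [] , wfBA , 0 , ι˘ , [] ,
  iso-cong (iso-trans (iso-sym YAB≅Y) (^-compose A B Y)) forth back
  where
  ι˘ : Formula L₁ 2
  ι˘ = renFormula (suc zero ∷ zero ∷ []) ι
  ι˘-⇔ : ∀ a (x : ∣ Y ^ compose A B ∣) (z : ∣ (Y ^ B) ^ A ∣) → proj₁ x ≡ proj₁ (proj₁ z) →
         Sat Y ι˘ ((a ∷ proj₁ (proj₁ z) ∷ []) ++ []) ⇔ Sat Y ι (proj₁ x ∷ a ∷ [])
  ι˘-⇔ a x z eq = Sat-rename Y ι _ (λ { zero → sym eq ; (suc zero) → refl })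
  through-YAB : ∣ Y ∣ → ∣ (Y ^ B) ^ A ∣ → Set
  through-YAB a z = Σ[ x ∈ ∣ Y ^ compose A B ∣ ] (Sat Y ι (proj₁ x ∷ a ∷ []) × proj₁ x ≡ proj₁ (proj₁ z))
  forth : ∀ a z → ¬ ¬ through-YAB a z → Sat Y ι˘ ((a ∷ proj₁ (proj₁ z) ∷ []) ++ [])
  forth a z h = Sat-stable Y ι˘ _ (do
    (x , s , eq) ← h
    return (from (ι˘-⇔ a x z eq) s))
  back : ∀ a z → Sat Y ι˘ ((a ∷ proj₁ (proj₁ z) ∷ []) ++ []) → ¬ ¬ ¬ ¬ through-YAB a z
  back a z s = do
    (x , eq) ← surjective (^-compose A B Y) z
    return (return (x , to (ι˘-⇔ a x z eq) s , eq))

isRetract-respects-≅ʳ : ∀ {L₁ L₂} {X : Structure L₁} {Y Y' : Structure L₂} {h : ∣ Y ∣ → ∣ Y' ∣ → Set} →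
                        IsRetractStr X Y → IsIsomorphism Y Y' h → IsRetractStr X Y'
isRetract-respects-≅ʳ (p , 𝖭 , c , wf , (_ , XN≅Y) , rest) Y≅Y' =
  p , 𝖭 , c , wf , (_ , iso-trans XN≅Y Y≅Y') , rest

iso-definable-transfer :
  ∀ {L} {W Y A B : Structure L} {h : ∣ W ∣ → ∣ Y ∣ → Set} {s}
  (eltA : ∣ A ∣ → ∣ W ∣) (eltB : ∣ B ∣ → ∣ Y ∣) → IsIsomorphism W Y h →
  IsIsomorphism A B (λ x z → h (eltA x) (eltB z)) →
  (ι : Formula L (2 + s)) (eW : Vector ∣ W ∣ s) (eY : Vector ∣ Y ∣ s) → (∀ j → h (eW j) (eY j)) →
  IsIsomorphism Y B (λ y z → Sat Y ι ((y ∷ eltB z ∷ []) ++ eY)) →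
  IsIsomorphism W A (λ w x → Sat W ι ((w ∷ eltA x ∷ []) ++ eW))
iso-definable-transfer {W = W} {h = h} eltA eltB W≅Y A≅B ι eW eY heW Y≅B =
  iso-cong (iso-trans (iso-trans W≅Y Y≅B) (iso-sym A≅B))
    (λ w x H → Sat-stable W ι _ (do
      (z , H′ , hxz) ← H
      (y , hwy , s) ← H′
      return (Sat-iso (iso-sym W≅Y) ι
                (++⁺ (λ u v → h v u) (λ { zero → hwy ; (suc zero) → hxz }) heW) s)))
    (λ w x s → do
      (y , hwy) ← total W≅Y w
      (z , hxz) ← total A≅B x
      let s′ = Sat-iso W≅Y ι (++⁺ h (λ { zero → hwy ; (suc zero) → hxz }) heW) s
      return (return (z , return (y , hwy , s′) , hxz)))

isRetract-respects-≅ˡ : ∀ {L₁ L₂} {W Y : Structure L₁} {Z : Structure L₂} {h : ∣ W ∣ → ∣ Y ∣ → Set} →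
                        IsIsomorphism W Y h → IsRetractStr Y Z → ¬ ¬ IsRetractStr W Z
isRetract-respects-≅ˡ W≅Y (p , 𝖭 , c , wfN , (_ , YN≅Z) , q , 𝖬 , d , wfNM , s , ι , e , Y≅YNM) = do
  (c′ , hc) ← ¬¬-choice-Fin p (surjective W≅Y ∘ c)
  let WN≅YN = iso-^ᴵ 𝖭 W≅Y c′ c hc
  (d′ , hd) ← ¬¬-choice-Fin q (surjective WN≅YN ∘ d)
  let WNM≅YNM = iso-^ᴵ 𝖬 WN≅YN d′ d hd
  (e′ , he) ← ¬¬-choice-Fin s (surjective W≅Y ∘ e)
  return (p , 𝖭 , c′ , wellFormed-iso WN≅YN wfN , (_ , iso-trans WN≅YN YN≅Z) ,
          q , 𝖬 , d′ , wellFormed-iso WNM≅YNM wfNM , s , ι , e′ ,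
          iso-definable-transfer (proj₁ ∘ proj₁) (proj₁ ∘ proj₁) W≅Y WNM≅YNM ι e′ e he Y≅YNM)

module _ {L₁ L₂ : Signature} {p q s₁ s₂ : ℕ}
         (𝖭 : Interpretation L₂ L₁ p) (𝖬 : Interpretation L₁ L₂ q)
         (ι₁ : Formula L₁ (2 + s₁)) (ι₂ : Formula L₂ (2 + s₂)) where
  private
    module 𝖭 = Interpretation 𝖭
    module 𝖬 = Interpretation 𝖬

    param : Fin (s₁ + (s₂ + (q + p))) → Fin (3 + (s₁ + (s₂ + (q + p))))
    param j = suc (suc (suc j))
    e₁-vars : Vector (Fin (3 + (s₁ + (s₂ + (q + p))))) s₁
    e₁-vars j = param (j ↑ˡ (s₂ + (q + p)))
    e₂-vars : Vector (Fin (3 + (s₁ + (s₂ + (q + p))))) s₂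
    e₂-vars j = param (s₁ ↑ʳ (j ↑ˡ (q + p)))
    d-vars : Vector (Fin (3 + (s₁ + (s₂ + (q + p))))) q
    d-vars j = param (s₁ ↑ʳ (s₂ ↑ʳ (j ↑ˡ p)))
    c-vars : Vector (Fin (3 + (s₁ + (s₂ + (q + p))))) p
    c-vars j = param (s₁ ↑ʳ (s₂ ↑ʳ (q ↑ʳ j)))

    in-𝖭 in-𝖬 ι₁-holds ι₂-holds : Formula L₁ (3 + (s₁ + (s₂ + (q + p))))
    in-𝖭     = renFormula ((zero ∷ []) ++ c-vars) 𝖭.domain
    in-𝖬     = translate 𝖭 𝖬.domain ((zero ∷ []) ++ d-vars) c-vars
    ι₁-holds = renFormula ((suc zero ∷ zero ∷ []) ++ e₁-vars) ι₁
    ι₂-holds = translate 𝖭 ι₂ ((zero ∷ suc (suc zero) ∷ []) ++ e₂-vars) c-vars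

    body : Formula L₁ (3 + (s₁ + (s₂ + (q + p))))
    body = in-𝖭 ∧' in-𝖬 ∧' ι₁-holds ∧' ι₂-holds

  -- ∃ z. ι₁(a, z) ∧ ι₂(z, b), with z ranging over the copy of (X^𝖭)^𝖬 inside X;
  -- the parameters are those of ι₁, of ι₂, of 𝖬 and of 𝖭, in this order.
  composite : Formula L₁ (2 + (s₁ + (s₂ + (q + p))))
  composite = ∃' body

  module _ (X : Structure L₁) (c : Vector ∣ X ∣ p) (d : Vector ∣ _^ᴵ_ 𝖭 X c ∣ q)
           (e₁ : Vector ∣ X ∣ s₁) (e₂ : Vector ∣ _^ᴵ_ 𝖭 X c ∣ s₂) where
    private
      W : Structure L₂
      W = _^ᴵ_ 𝖭 X c
      params : Vector ∣ X ∣ (s₁ + (s₂ + (q + p)))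
      params = e₁ ++ ((proj₁ ∘ e₂) ++ ((proj₁ ∘ d) ++ c))

    Sat-composite : ∀ a b (b′ : ∣ W ∣) → proj₁ b′ ≡ b →
      Sat X composite ((a ∷ b ∷ []) ++ params)
        ⇔ (¬ ¬ (Σ[ u ∈ ∣ _^ᴵ_ 𝖬 W d ∣ ] (Sat X ι₁ ((a ∷ proj₁ (proj₁ u) ∷ []) ++ e₁) ×
                                        Sat W ι₂ ((proj₁ u ∷ b′ ∷ []) ++ e₂))))
    Sat-composite a b b′ b′≡b = mk⇔
      (λ s → do
        (z , sb) ← to (Sat-∃ X body _) s
        let (in-𝖭-sat , in-𝖬-sat , ι₁-sat , ι₂-sat) = to (split z) sb
            w = z , to (𝖭-⇔ z) in-𝖭-sat
        return ((w , to (𝖬-⇔ w) in-𝖬-sat) , to (ι₁-⇔ z) ι₁-sat , to (ι₂-⇔ w) ι₂-sat))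
      (λ h → from (Sat-∃ X body _) (do
        (((z , d𝖭) , d𝖬) , ι₁-sat , ι₂-sat) ← h
        return (z , from (split z)
          ( from (𝖭-⇔ z) d𝖭 , from (𝖬-⇔ (z , d𝖭)) d𝖬
          , from (ι₁-⇔ z) ι₁-sat , from (ι₂-⇔ (z , d𝖭)) ι₂-sat))))
      where
      env : ∣ X ∣ → Vector ∣ X ∣ (3 + (s₁ + (s₂ + (q + p))))
      env z = z ∷ ((a ∷ b ∷ []) ++ params)
      e₁-fit : ∀ z j → env z (e₁-vars j) ≡ e₁ j
      e₁-fit z j = lookup-++ˡ e₁ _ j
      e₂-fit : ∀ z j → env z (e₂-vars j) ≡ proj₁ (e₂ j)
      e₂-fit z j = trans (lookup-++ʳ e₁ _ _) (lookup-++ˡ (proj₁ ∘ e₂) _ j)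
      d-fit : ∀ z j → env z (d-vars j) ≡ proj₁ (d j)
      d-fit z j = trans (lookup-++ʳ e₁ _ _)
                    (trans (lookup-++ʳ (proj₁ ∘ e₂) _ _) (lookup-++ˡ (proj₁ ∘ d) c j))
      c-fit : ∀ z j → env z (c-vars j) ≡ c j
      c-fit z j = trans (lookup-++ʳ e₁ _ _)
                    (trans (lookup-++ʳ (proj₁ ∘ e₂) _ _) (lookup-++ʳ (proj₁ ∘ d) c j))

      split : ∀ z → Sat X body (env z)
                    ⇔ (Sat X in-𝖭 (env z) × Sat X in-𝖬 (env z) ×
                       Sat X ι₁-holds (env z) × Sat X ι₂-holds (env z))
      split z =
        Sat-∧-⇔ X in-𝖭 (in-𝖬 ∧' ι₁-holds ∧' ι₂-holds) (⇔-id _)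
          (Sat-∧-⇔ X in-𝖬 (ι₁-holds ∧' ι₂-holds) (⇔-id _)
            (Sat-∧-⇔ X ι₁-holds ι₂-holds (⇔-id _) (⇔-id _)))
      𝖭-⇔ : ∀ z → Sat X in-𝖭 (env z) ⇔ Sat X 𝖭.domain ((z ∷ []) ++ c)
      𝖭-⇔ z = Sat-inst 𝖭 X c 𝖭.domain _ _ (λ { zero → refl }) (c-fit z)
      𝖬-⇔ : ∀ w → Sat X in-𝖬 (env (proj₁ w)) ⇔ Sat W 𝖬.domain ((w ∷ []) ++ d)
      𝖬-⇔ w = Sat-translate 𝖭 X c 𝖬.domain _ _
                (++⁺ (λ i v → env (proj₁ w) i ≡ proj₁ v) (λ { zero → refl }) (d-fit (proj₁ w)))
                (c-fit (proj₁ w))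
      ι₁-⇔ : ∀ z → Sat X ι₁-holds (env z) ⇔ Sat X ι₁ ((a ∷ z ∷ []) ++ e₁)
      ι₁-⇔ z = Sat-rename X ι₁ _
                 (++⁺ (λ i v → env z i ≡ v) (λ { zero → refl ; (suc zero) → refl }) (e₁-fit z))
      ι₂-⇔ : ∀ w → Sat X ι₂-holds (env (proj₁ w)) ⇔ Sat W ι₂ ((w ∷ b′ ∷ []) ++ e₂)
      ι₂-⇔ w = Sat-translate 𝖭 X c ι₂ _ _
                 (++⁺ (λ i v → env (proj₁ w) i ≡ proj₁ v)
                      (λ { zero → refl ; (suc zero) → sym b′≡b }) (e₂-fit (proj₁ w)))
                 (c-fit (proj₁ w))

module _ {L₁ L₂ L₃ : Signature} {X : Structure L₁} {Z : Structure L₃} {p₁ q₁ s₁ : ℕ}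
  (𝖭₁ : Interpretation L₂ L₁ p₁) (c₁ : Vector ∣ X ∣ p₁)
  (𝖬₁ : Interpretation L₁ L₂ q₁) (d₁ : Vector ∣ _^ᴵ_ 𝖭₁ X c₁ ∣ q₁)
  (wf-WM₁ : IsWellFormed (_^ᴵ_ 𝖬₁ (_^ᴵ_ 𝖭₁ X c₁) d₁))
  (ι₁ : Formula L₁ (2 + s₁)) (e₁ : Vector ∣ X ∣ s₁)
  (X≅WM₁ : IsIsomorphism X (_^ᴵ_ 𝖬₁ (_^ᴵ_ 𝖭₁ X c₁) d₁)
                          (λ a u → Sat X ι₁ ((a ∷ proj₁ (proj₁ u) ∷ []) ++ e₁)))
  where

  private
    W : Structure L₂
    W = _^ᴵ_ 𝖭₁ X c₁

  isRetract-trans-^ᴵ : IsRetractStr W Z → ¬ ¬ IsRetractStr X Z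
  isRetract-trans-^ᴵ (p₂ , 𝖭₂ , c₂ , wf-WN₂ , (_ , WN₂≅Z) , q₂ , 𝖬₂ , d₂ , _ , s₂ , ι₂ , e₂ , W≅WN₂M₂) = do
    (d₂* , hd₂) ← ¬¬-choice-Fin q₂ (surjective XN≅WN₂ ∘ d₂)
    let XNM₂≅WN₂M₂ = iso-^ᴵ 𝖬₂ XN≅WN₂ d₂* d₂ hd₂
        W≅XNM₂     = iso-trans W≅WN₂M₂ (iso-sym XNM₂≅WN₂M₂)
    (d₁* , hd₁) ← ¬¬-choice-Fin q₁ (total W≅XNM₂ ∘ d₁)
    let WM₁≅V  = iso-^ᴵ 𝖬₁ W≅XNM₂ d₁ d₁* hd₁
        XNM≅V  = ^ᴵ-composeᴵ 𝖬₁ 𝖬₂ XN d₂* d₁*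
        ι      = composite 𝖭₁ 𝖬₁ ι₁ ι₂
        Sat-ι  = Sat-composite 𝖭₁ 𝖬₁ ι₁ ι₂ X c₁ d₁ e₁ e₂
    return ( p₂ + p₁ , composeᴵ 𝖭₂ 𝖭₁ , c
           , wellFormed-iso XN≅WN₂ wf-WN₂ , (_ , iso-trans XN≅WN₂ WN₂≅Z)
           , q₁ + q₂ , composeᴵ 𝖬₁ 𝖬₂ , (proj₁ ∘ d₁*) ++ d₂*
           , wellFormed-iso (iso-trans XNM≅V (iso-sym WM₁≅V)) wf-WM₁
           , _ , ι , e₁ ++ ((proj₁ ∘ e₂) ++ ((proj₁ ∘ d₁) ++ c₁))
           , iso-cong (iso-trans (iso-trans X≅WM₁ WM₁≅V) (iso-sym XNM≅V))
               (λ a x H → Sat-stable X ι _ (do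
                  (v , H′ , x≡v) ← H
                  (u , ι₁-sat , G) ← H′
                  (z , ι₂-sat , v≡z) ← G
                  let z≡x = sym (trans (cong proj₁ x≡v) v≡z)
                  return (from (Sat-ι a _ (proj₁ (proj₁ z)) z≡x) (return (u , ι₁-sat , ι₂-sat)))))
               (λ a x sat → do
                  (v , x≡v) ← total XNM≅V x
                  (z , v≡z) ← total XNM₂≅WN₂M₂ (proj₁ v)
                  let z≡x = sym (trans (cong proj₁ x≡v) v≡z)
                  (u , ι₁-sat , ι₂-sat) ← to (Sat-ι a _ (proj₁ (proj₁ z)) z≡x) sat
                  return (return (v , return (u , ι₁-sat , return (z , ι₂-sat , v≡z)) , x≡v))))
    where
    c : Vector ∣ X ∣ (p₂ + p₁)
    c = (proj₁ ∘ c₂) ++ c₁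
    XN : Structure L₃
    XN = _^ᴵ_ (composeᴵ 𝖭₂ 𝖭₁) X c
    XN≅WN₂ : IsIsomorphism XN (_^ᴵ_ 𝖭₂ W c₂) (λ x y → proj₁ x ≡ proj₁ (proj₁ y))
    XN≅WN₂ = ^ᴵ-composeᴵ 𝖭₂ 𝖭₁ X c₁ c₂

isRetract-trans : ∀ {L₁ L₂ L₃} {X : Structure L₁} {Y : Structure L₂} {Z : Structure L₃} →
                  IsRetractStr X Y → IsRetractStr Y Z → ¬ ¬ IsRetractStr X Z
isRetract-trans (_ , 𝖭₁ , c₁ , _ , (_ , W≅Y) , _ , 𝖬₁ , d₁ , wf-WM₁ , _ , ι₁ , e₁ , X≅WM₁) Y⊴Z = do
  W⊴Z ← isRetract-respects-≅ˡ W≅Y Y⊴Z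
  isRetract-trans-^ᴵ 𝖭₁ c₁ 𝖬₁ d₁ wf-WM₁ ι₁ e₁ X≅WM₁ W⊴Z

model-isRetract-^ : ∀ {L₁ L₂} {T₁ : Theory L₁} {T₂ : Theory L₂}
                    {I : Translation L₁ L₂} {J : Translation L₂ L₁} →
                    IsInterpretation I T₁ T₂ → IsInterpretation J T₂ T₁ →
                    ProvablyIsoToIdentity (compose I J) T₁ →
                    ∀ M → M ⊨ᵀ T₁ → IsRetractStr M (M ^ J)
model-isRetract-^ {J = J} I-int J-int (ι , IJ≅id) M M⊨T₁ =
  isRetract-^ M J _ (proj₁ J-int M M⊨T₁) (proj₁ I-int (M ^ J) (^-preserves-⊨ J-int M M⊨T₁))
              ι (IJ≅id M M⊨T₁)

biInterpretable-isRetract-of-model : ∀ {L₁ L₂} {T₁ : Theory L₁} {T₂ : Theory L₂} → BiInterpretable T₁ T₂ →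
  ∀ N → N ⊨ᵀ T₂ → Σ[ N′ ∈ Structure L₁ ] (N′ ⊨ᵀ T₁ × IsRetractStr N N′)
biInterpretable-isRetract-of-model (I , J , I-int , J-int , _ , JI≅id) N N⊨T₂ =
  N ^ I , ^-preserves-⊨ I-int N N⊨T₂ , model-isRetract-^ J-int I-int JI≅id N N⊨T₂

biInterpretable-model-isRetract : ∀ {L₁ L₂} {T₁ : Theory L₁} {T₂ : Theory L₂} → BiInterpretable T₁ T₂ →
  ∀ M → M ⊨ᵀ T₂ → Σ[ M′ ∈ Structure L₁ ] (M′ ⊨ᵀ T₁ × IsRetractStr M′ M)
biInterpretable-model-isRetract {T₁ = T₁} (I , J , I-int , J-int , IJ≅id , (_ , JI≅id)) M M⊨T₂ =
  M ^ I , M′⊨T₁ ,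
  isRetract-respects-≅ʳ (model-isRetract-^ I-int J-int IJ≅id (M ^ I) M′⊨T₁)
                        (iso-trans (iso-sym (^-compose J I M)) (JI≅id M M⊨T₂))
  where
  M′⊨T₁ : (M ^ I) ⊨ᵀ T₁
  M′⊨T₁ = ^-preserves-⊨ I-int M M⊨T₂

corollary4p14 : (LU LV : ℕ → Signature)
    (U : (k : ℕ) → Theory (LU k)) (V : (k : ℕ) → Theory (LV k)) →
    ((k : ℕ) → BiInterpretable (U k) (V k)) →
    RetractDisjoint LU U → RetractDisjoint LV V
corollary4p14 LU LV U V bi U-disjoint k n M N M⊨Vₖ N⊨Vₙ M⊴N =
  let (M′ , M′⊨Uₖ , M′⊴M) = biInterpretable-model-isRetract (bi k) M M⊨Vₖ
      (N′ , N′⊨Uₙ , N⊴N′) = biInterpretable-isRetract-of-model (bi n) N N⊨Vₙ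
  in decidable-stable (k ≟ n) (do
       M′⊴N ← isRetract-trans M′⊴M M⊴N
       M′⊴N′ ← isRetract-trans M′⊴N N⊴N′
       return (U-disjoint k n M′ N′ M′⊨Uₖ N′⊨Uₙ M′⊴N′))
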